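{- Let $k\geq 3$ be an integer and let $A_k$ be a set of positive integers that contains no $k$-term geometric progression. Then \[ d_U(A_k) \leq 1 - \frac{1}{2^k -1} - \frac{2}{5}\left( \frac{1}{5^{k-1}} - \frac{1}{6^{k-1}} \right) - \frac{4}{15}\left( \frac{1}{7^{k-1}} - \frac{1}{10^{k-1}} \right). \]
   Context: A $k$-term geometric progression is a sequence $(a_0,a_1,\ldots,a_{k-1})$ of nonzero real numbers for which there is a real number $r\neq 0,\pm1$ with $a_i/a_{i-1}=r$ for $i=1,\ldots,k-1$; a set contains it if all $a_i$ belong to the set. For a set $A$ of positive integers, $A(n)$ denotes the number of $a\in A$ with $a\leq n$, and the upper asymptotic density is $d_U(A)=\limsup_{n\to\infty} A(n)/n$. -}

module Defs where

open import Data.Nat as ℕ using (ℕ; zero; suc; _^_; _∸_)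
open import Data.Integer using (+_)
open import Data.Rational using (ℚ; _/_; _+_; _-_; _*_; _≤_; _<_; 0ℚ; 1ℚ)
open import Data.Bool using (Bool; true; false; if_then_else_)
open import Data.Product using (Σ; ∃; _×_)
open import Relation.Binary.PropositionalEquality using (_≡_; _≢_)
open import Relation.Nullary using (¬_)

Set⁺ : Set
Set⁺ = ℕ → Bool

count : Set⁺ → ℕ → ℕ
count A zero = zero
count A (suc n) = count A n ℕ.+ (if A (suc n) then 1 else 0)

-- 1/n as a rational (with the junk value 1/0 := 0, only used for n ≥ 1)
inv : ℕ → ℚ
inv zero = 0ℚ
inv (suc n) = + 1 / suc n

ratio : Set⁺ → ℕ → ℚ
ratio A m = + count A (suc m) / suc m

-- d_U(A) = limsup A(n)/n ≤ c, unfolded: for every ε > 0, eventually A(n)/n ≤ c + ε.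
UpperDensity≤ : Set⁺ → ℚ → Set
UpperDensity≤ A c = (ε : ℚ) → 0ℚ < ε → ∃ λ N → (m : ℕ) → N ℕ.≤ m → ratio A m ≤ c + ε

-- A contains the k-term geometric progression (a 0, …, a (k-1)):
-- all terms are in A, and there is a ratio r with r ≠ 0, ±1 and a (i+1) = r · a i.
-- Since the terms are positive integers, r = a₁/a₀ is necessarily a positive rational;
-- we write r = p / q with p, q positive naturals, p ≢ q (r ≠ 1), and the ratio condition
-- a (i+1) / a i = p / q cleared of denominators.
ContainsGP : ℕ → Set⁺ → Set
ContainsGP k A =
  Σ (ℕ → ℕ) λ a → Σ ℕ λ p → Σ ℕ λ q →
    (0 ℕ.< p) × (0 ℕ.< q) × (p ≢ q) ×
    ((i : ℕ) → i ℕ.< k → (0 ℕ.< a i) × (A (a i) ≡ true)) ×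
    ((i : ℕ) → suc i ℕ.< k → q ℕ.* a (suc i) ≡ p ℕ.* a i)

bound : ℕ → ℚ
bound k =
  1ℚ - inv (2 ^ k ∸ 1)
     - (+ 2 / 5) * (inv (5 ^ (k ∸ 1)) - inv (6 ^ (k ∸ 1)))
     - (+ 4 / 15) * (inv (7 ^ (k ∸ 1)) - inv (10 ^ (k ∸ 1)))

module Submission where

-- Inside [1, n] we place many pairwise disjoint k-term geometric progressions; each contains a
-- non-element of A, so A(n) ≤ n minus the number of progressions.
--   • ratio 2: m·2^{jk}, …, m·2^{jk+k-1} with m odd and m ≤ n/2^{jk+k-1}, one layer for each j;
--     the layers are separated by 2-adic valuation and together give about n/(2^k - 1) progressions;
--   • ratio 5/3: a·3^{k-1-i}·5^i with a coprime to 10 and n/6^{k-1} < a ≤ n/5^{k-1},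
--     about (2/5)(1/5^{k-1} - 1/6^{k-1})n of them;
--   • ratio 7/5: a·5^{k-1-i}·7^i with a coprime to 30 and n/10^{k-1} < a ≤ n/7^{k-1},
--     about (4/15)(1/7^{k-1} - 1/10^{k-1})n of them.
-- Terms of the last two families are odd and exceed n/2^{k-1}, while the odd terms of the first
-- family are at most n/2^{k-1}; 3- and 5-adic valuations separate the last two families.
-- With 2E layers and n ≥ 2E(2E + 14) the truncation and rounding losses are at most 1/E ≤ ε.

open import Data.Bool using (Bool; true; false; not; if_then_else_; _∧_)
import Data.Bool.Properties as Bool
open import Data.Empty using (⊥; ⊥-elim)
open import Data.Integer as ℤ using ()
import Data.Integer.Properties as ℤ
import Data.Integer.Tactic.RingSolver as ℤ
open import Data.List using (List; []; _∷_; _++_; length; map)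
open import Data.List.Properties using (length-map; length-++)
open import Data.List.Relation.Unary.All as All using (All; []; _∷_)
import Data.List.Relation.Unary.All.Properties as All
open import Data.List.Relation.Unary.AllPairs as AllPairs using (AllPairs; []; _∷_)
import Data.List.Relation.Unary.AllPairs.Properties as AllPairs
open import Data.List.Relation.Unary.Unique.Propositional using (Unique)
import Data.List.Relation.Unary.Unique.Propositional.Properties as Unique
open import Data.Nat
open import Data.Nat.Coprimality using (1-coprimeTo)
import Data.Nat.Coprimality as Coprime
open import Data.Nat.Divisibility using (_∣_; _∣?_; divides; n∣m*n; n∣m⇒m%n≡0; ∣1⇒≡1)
open import Data.Nat.DivMod
  using (m≡m%n+[m/n]*n; m%n<n; m/n*n≤m; /-monoʳ-≤; [m+kn]%n≡m%n; +-distrib-/-∣ˡ; m*n/n≡m; m<n⇒m/n≡0)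
open import Data.Nat.Primality using (Prime; prime?; prime[2]; euclidsLemma; ¬prime[1]; prime⇒nonZero)
open import Data.Nat.Properties
open import Data.Nat.Tactic.RingSolver using (solve-∀)
open import Data.Product using (∃; _×_; _,_; proj₁; proj₂)
open import Data.Rational as ℚ using (ℚ; mkℚ; 0ℚ; 1ℚ; toℚᵘ)
import Data.Rational.Properties as ℚ
open import Data.Rational.Solver using (module +-*-Solver)
import Data.Rational.Unnormalised as ℚᵘ
import Data.Rational.Unnormalised.Properties as ℚᵘ
open import Data.Sum using (inj₁; inj₂)
open import Defs
open import Function using (_∘_)
open import Relation.Binary.PropositionalEquality hiding (J)
open import Relation.Nullary using (¬_; yes; no)
open import Relation.Nullary.Decidable using (from-no; from-yes)

*-pos : ∀ {m n} → 0 < m → 0 < n → 0 < m * n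
*-pos {suc _} {suc _} _ _ = s≤s z≤n

n<2^n : ∀ n → n < 2 ^ n
n<2^n zero = s≤s z≤n
n<2^n (suc n) = begin-strict
  suc n          ≤⟨ n<2^n n ⟩
  2 ^ n          <⟨ m<m+n (2 ^ n) (m^n>0 2 n) ⟩
  2 ^ n + 2 ^ n  ≡⟨ cong (2 ^ n +_) (+-identityʳ (2 ^ n)) ⟨
  2 ^ suc n      ∎
  where open ≤-Reasoning

[m*n]^e≡m^e*n^e : ∀ m n e → (m * n) ^ e ≡ m ^ e * n ^ e
[m*n]^e≡m^e*n^e m n zero = refl
[m*n]^e≡m^e*n^e m n (suc e) rewrite [m*n]^e≡m^e*n^e m n e = interchange m n (m ^ e) (n ^ e)
  where interchange : ∀ a b c d → a * b * (c * d) ≡ a * c * (b * d)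
        interchange = solve-∀

[k∸1]∸i≡suc : ∀ k i → suc i < k → k ∸ 1 ∸ i ≡ suc (k ∸ 1 ∸ suc i)
[k∸1]∸i≡suc (suc zero) zero (s≤s ())
[k∸1]∸i≡suc (suc (suc k)) zero _ = refl
[k∸1]∸i≡suc (suc (suc k)) (suc i) (s≤s i<k) = [k∸1]∸i≡suc (suc k) i i<k

[k∸1]∸i+i≡k∸1 : ∀ k i → i < k → k ∸ 1 ∸ i + i ≡ k ∸ 1
[k∸1]∸i+i≡k∸1 (suc k) i (s≤s i≤k) = m∸n+n≡m i≤k

n<[n/d+1]*d : ∀ n d .{{_ : NonZero d}} → n < suc (n / d) * d
n<[n/d+1]*d n d = begin-strict
  n                   ≡⟨ m≡m%n+[m/n]*n n d ⟩
  n % d + n / d * d   <⟨ +-monoˡ-< (n / d * d) (m%n<n n d) ⟩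
  d + n / d * d       ∎
  where open ≤-Reasoning

≤/⇒*≤ : ∀ {x} n d .{{_ : NonZero d}} → x ≤ n / d → x * d ≤ n
≤/⇒*≤ n d x≤n/d = ≤-trans (*-monoˡ-≤ d x≤n/d) (m/n*n≤m n d)

/<⇒<* : ∀ {x} n d .{{_ : NonZero d}} → n / d < x → n < x * d
/<⇒<* n d n/d<x = <-≤-trans (n<[n/d+1]*d n d) (*-monoˡ-≤ d n/d<x)

[m*n+o]/n≡m : ∀ m n o .{{_ : NonZero n}} → o < n → (m * n + o) / n ≡ m
[m*n+o]/n≡m m n o o<n = begin
  (m * n + o) / n   ≡⟨ +-distrib-/-∣ˡ o (n∣m*n m) ⟩
  m * n / n + o / n ≡⟨ cong₂ _+_ (m*n/n≡m m n) (m<n⇒m/n≡0 o<n) ⟩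
  m + 0             ≡⟨ +-identityʳ m ⟩
  m                 ∎
  where open ≡-Reasoning

sum< : ℕ → (ℕ → ℕ) → ℕ
sum< zero x = 0
sum< (suc J) x = sum< J x + x J

-- Σ_{j<J} x j ≥ n (1 - (1+K)^{-J}) / K, with denominators cleared.
geometric-lower-bound : ∀ K (x : ℕ → ℕ) n J → (∀ j → n ≤ suc K ^ suc j * x j) →
                        n * suc K ^ J ≤ K * suc K ^ J * sum< J x + n
geometric-lower-bound K x n zero _ = ≤-trans (≤-reflexive (*-identityʳ n)) (m≤n+m n _)
geometric-lower-bound K x n (suc J) n≤ = begin
  n * (suc K * G)                                 ≡⟨ swap n K G ⟩
  suc K * (n * G)                                 ≤⟨ *-monoʳ-≤ (suc K) (geometric-lower-bound K x n J n≤) ⟩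
  suc K * (K * G * S + n)                         ≡⟨ expand K G S n ⟩
  K * (suc K * G) * S + n + K * n                 ≤⟨ +-monoʳ-≤ _ (*-monoʳ-≤ K (n≤ J)) ⟩
  K * (suc K * G) * S + n + K * (suc K * G * x J) ≡⟨ collect K G S n (x J) ⟩
  K * (suc K * G) * (S + x J) + n                 ∎
  where
  open ≤-Reasoning
  G = suc K ^ J
  S = sum< J x
  swap : ∀ n K G → n * (suc K * G) ≡ suc K * (n * G)
  swap = solve-∀
  expand : ∀ K G S n → suc K * (K * G * S + n) ≡ K * (suc K * G) * S + n + K * n
  expand = solve-∀
  collect : ∀ K G S n y → K * (suc K * G) * S + n + K * (suc K * G * y) ≡ K * (suc K * G) * (S + y) + n
  collect = solve-∀

prime-3 : Prime 3
prime-3 = from-yes (prime? 3)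

prime-5 : Prime 5
prime-5 = from-yes (prime? 5)

∤-* : ∀ {p} m n → Prime p → ¬ p ∣ m → ¬ p ∣ n → ¬ p ∣ m * n
∤-* m n pr p∤m p∤n p∣mn with euclidsLemma m n pr p∣mn
... | inj₁ p∣m = p∤m p∣m
... | inj₂ p∣n = p∤n p∣n

∤-^ : ∀ {p} m e → Prime p → ¬ p ∣ m → ¬ p ∣ m ^ e
∤-^ m zero pr p∤m p∣1 = ¬prime[1] (subst Prime (∣1⇒≡1 p∣1) pr)
∤-^ m (suc e) pr p∤m = ∤-* m (m ^ e) pr p∤m (∤-^ m e pr p∤m)

^-*-injective : ∀ p e e′ u u′ .{{_ : NonZero p}} → ¬ p ∣ u → ¬ p ∣ u′ →
                p ^ e * u ≡ p ^ e′ * u′ → e ≡ e′ × u ≡ u′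
^-*-injective p zero zero u u′ _ _ eq = refl , trans (sym (+-identityʳ u)) (trans eq (+-identityʳ u′))
^-*-injective p zero (suc e′) u u′ p∤u _ eq =
  ⊥-elim (p∤u (divides (p ^ e′ * u′) (trans (sym (+-identityʳ u)) (trans eq (rotate p (p ^ e′) u′)))))
  where rotate : ∀ a b c → a * b * c ≡ b * c * a
        rotate = solve-∀
^-*-injective p (suc e) zero u u′ _ p∤u′ eq =
  ⊥-elim (p∤u′ (divides (p ^ e * u) (trans (sym (+-identityʳ u′)) (trans (sym eq) (rotate p (p ^ e) u)))))
  where rotate : ∀ a b c → a * b * c ≡ b * c * a
        rotate = solve-∀
^-*-injective p (suc e) (suc e′) u u′ p∤u p∤u′ eq
  with ^-*-injective p e e′ u u′ p∤u p∤u′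
         (*-cancelˡ-≡ _ _ p (trans (sym (*-assoc p _ u)) (trans eq (*-assoc p _ u′))))
... | refl , u≡u′ = refl , u≡u′

_∤ᵇ_ : (d : ℕ) .{{_ : NonZero d}} → ℕ → Bool
d ∤ᵇ x = not (x % d ≡ᵇ 0)

∤ᵇ⇒∤ : ∀ d x .{{_ : NonZero d}} → (d ∤ᵇ x) ≡ true → ¬ d ∣ x
∤ᵇ⇒∤ d x d∤ᵇx d∣x rewrite n∣m⇒m%n≡0 x d d∣x = Bool.not-¬ refl d∤ᵇx

∤ᵇ-periodic : ∀ d x q .{{_ : NonZero d}} → d ∤ᵇ (x + q * d) ≡ d ∤ᵇ x
∤ᵇ-periodic d x q = cong (λ r → not (r ≡ᵇ 0)) ([m+kn]%n≡m%n x q d)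

odd coprime-10 coprime-30 : ℕ → Bool
odd x = 2 ∤ᵇ x
coprime-10 x = odd x ∧ 5 ∤ᵇ x
coprime-30 x = coprime-10 x ∧ 3 ∤ᵇ x

odd-periodic : ∀ x → odd (x + 2) ≡ odd x
odd-periodic x = ∤ᵇ-periodic 2 x 1

coprime-10-periodic : ∀ x → coprime-10 (x + 10) ≡ coprime-10 x
coprime-10-periodic x = cong₂ _∧_ (∤ᵇ-periodic 2 x 5) (∤ᵇ-periodic 5 x 2)

coprime-30-periodic : ∀ x → coprime-30 (x + 30) ≡ coprime-30 x
coprime-30-periodic x =
  cong₂ _∧_ (cong₂ _∧_ (∤ᵇ-periodic 2 x 15) (∤ᵇ-periodic 5 x 6)) (∤ᵇ-periodic 3 x 10)

odd⇒∤ : ∀ x → odd x ≡ true → ¬ 2 ∣ x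
odd⇒∤ x = ∤ᵇ⇒∤ 2 x

odd⇒pos : ∀ x → odd x ≡ true → 0 < x
odd⇒pos zero ()
odd⇒pos (suc x) _ = s≤s z≤n

coprime-10⇒odd : ∀ x → coprime-10 x ≡ true → odd x ≡ true
coprime-10⇒odd x = Bool.∧-conicalˡ (odd x) _

coprime-10⇒5∤ : ∀ x → coprime-10 x ≡ true → ¬ 5 ∣ x
coprime-10⇒5∤ x = ∤ᵇ⇒∤ 5 x ∘ Bool.∧-conicalʳ (odd x) _

coprime-30⇒coprime-10 : ∀ x → coprime-30 x ≡ true → coprime-10 x ≡ true
coprime-30⇒coprime-10 x = Bool.∧-conicalˡ (coprime-10 x) _

coprime-30⇒3∤ : ∀ x → coprime-30 x ≡ true → ¬ 3 ∣ x
coprime-30⇒3∤ x = ∤ᵇ⇒∤ 3 x ∘ Bool.∧-conicalʳ (coprime-10 x) _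

_∖_ : Set⁺ → ℕ → Set⁺
(B ∖ y) x with x ≟ y
... | yes _ = false
... | no _ = B x

∖-≢ : ∀ B {x y} → x ≢ y → (B ∖ y) x ≡ B x
∖-≢ B {x} {y} x≢y with x ≟ y
... | yes x≡y = ⊥-elim (x≢y x≡y)
... | no _ = refl

∖-≡ : ∀ B y → (B ∖ y) y ≡ false
∖-≡ B y with y ≟ y
... | yes _ = refl
... | no y≢y = ⊥-elim (y≢y refl)

count-∖-< : ∀ B {y} n → n < y → count (B ∖ y) n ≡ count B n
count-∖-< B zero _ = refl
count-∖-< B (suc n) n<y =
  cong₂ (λ a b → a + (if b then 1 else 0)) (count-∖-< B n (<-trans (n<1+n n) n<y)) (∖-≢ B (<⇒≢ n<y))

count-∖ : ∀ B {y} n → B y ≡ true → 1 ≤ y → y ≤ n → suc (count (B ∖ y) n) ≡ count B n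
count-∖ B {suc _} zero _ _ ()
count-∖ B {y} (suc n) By≡true 1≤y y≤1+n with y ≟ suc n
... | yes refl rewrite ∖-≡ B (suc n) | By≡true | count-∖-< B n (n<1+n n) =
  trans (cong suc (+-identityʳ (count B n))) (+-comm 1 (count B n))
... | no y≢1+n rewrite ∖-≢ B {suc n} (≢-sym y≢1+n) =
  cong (_+ (if B (suc n) then 1 else 0)) (count-∖ B n By≡true 1≤y (≤-pred (≤∧≢⇒< y≤1+n y≢1+n)))

Counted : Set⁺ → ℕ → ℕ → Set
Counted B n x = 1 ≤ x × x ≤ n × B x ≡ true

length≤count : ∀ B n {xs} → All (Counted B n) xs → Unique xs → length xs ≤ count B n
length≤count B n [] [] = z≤n
length≤count B n {y ∷ xs} ((1≤y , y≤n , By) ∷ counted) (y∉xs ∷ unique) =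
  subst (suc (length xs) ≤_) (count-∖ B n By 1≤y y≤n)
    (s≤s (length≤count (B ∖ y) n (All.zipWith still-counted (y∉xs , counted)) unique))
  where
  still-counted : ∀ {x} → y ≢ x × Counted B n x → Counted (B ∖ y) n x
  still-counted (y≢x , 1≤x , x≤n , Bx) = 1≤x , x≤n , trans (∖-≢ B (≢-sym y≢x)) Bx

count-complement : ∀ A n → count A n + count (not ∘ A) n ≡ n
count-complement A zero = refl
count-complement A (suc n) with A (suc n)
... | true = trans (cong₂ _+_ (+-comm (count A n) 1) (+-identityʳ _)) (cong suc (count-complement A n))
... | false = trans (cong₂ _+_ (+-identityʳ (count A n)) (+-comm _ 1))
                    (trans (+-suc (count A n) _) (cong suc (count-complement A n)))

select : (ℕ → Bool) → ℕ → ℕ → List ℕ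
select p lo zero = []
select p lo (suc len) with p lo
... | true = lo ∷ select p (suc lo) len
... | false = select p (suc lo) len

InWindow : (ℕ → Bool) → ℕ → ℕ → ℕ → Set
InWindow p lo len x = lo ≤ x × x < lo + len × p x ≡ true

InWindow-suc : ∀ {p lo len x} → InWindow p (suc lo) len x → InWindow p lo (suc len) x
InWindow-suc {lo = lo} {len} {x} (lo<x , x<lo+1+len , px) = <⇒≤ lo<x , subst (x <_) (sym (+-suc lo len)) x<lo+1+len , px

select-sound : ∀ p lo len → All (InWindow p lo len) (select p lo len)
select-sound p lo zero = []
select-sound p lo (suc len) with p lo in plo
... | true = (≤-refl , m<m+n lo (s≤s z≤n) , plo) ∷ All.map (InWindow-suc {p}) (select-sound p (suc lo) len)
... | false = All.map (InWindow-suc {p}) (select-sound p (suc lo) len)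

select-unique : ∀ p lo len → Unique (select p lo len)
select-unique p lo zero = []
select-unique p lo (suc len) with p lo
... | true = All.map (<⇒≢ ∘ proj₁) (select-sound p (suc lo) len) ∷ select-unique p (suc lo) len
... | false = select-unique p (suc lo) len

#select : (ℕ → Bool) → ℕ → ℕ → ℕ
#select p lo len = length (select p lo len)

#select-suc : ∀ p lo len → #select p lo (suc len) ≡ (if p lo then 1 else 0) + #select p (suc lo) len
#select-suc p lo len with p lo
... | true = refl
... | false = refl

#select-+ : ∀ p lo a b → #select p lo (a + b) ≡ #select p lo a + #select p (lo + a) b
#select-+ p lo zero b = cong (λ lo′ → #select p lo′ b) (sym (+-identityʳ lo))
#select-+ p lo (suc a) b
  rewrite #select-suc p lo (a + b) | #select-suc p lo a | #select-+ p (suc lo) a b | +-suc lo a =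
  sym (+-assoc (if p lo then 1 else 0) _ _)

#select-mono : ∀ p lo a b → #select p lo a ≤ #select p lo (a + b)
#select-mono p lo a b = subst (#select p lo a ≤_) (sym (#select-+ p lo a b)) (m≤m+n _ _)

module Periodic (p : ℕ → Bool) (T : ℕ) .{{_ : NonZero T}} (periodic : ∀ x → p (x + T) ≡ p x) where

  #period : ℕ
  #period = #select p 0 T

  #select-shift : ∀ lo → #select p (suc lo) T ≡ #select p lo T
  #select-shift lo = +-cancelˡ-≡ (if p lo then 1 else 0) _ _ (begin
    (if p lo then 1 else 0) + #select p (suc lo) T       ≡⟨ #select-suc p lo T ⟨
    #select p lo (suc T)                                 ≡⟨ cong (#select p lo) (+-comm 1 T) ⟩
    #select p lo (T + 1)                                 ≡⟨ #select-+ p lo T 1 ⟩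
    #select p lo T + #select p (lo + T) 1                ≡⟨ cong (#select p lo T +_) (#select-suc p (lo + T) 0) ⟩
    #select p lo T + ((if p (lo + T) then 1 else 0) + 0) ≡⟨ cong (λ b → #select p lo T + ((if b then 1 else 0) + 0)) (periodic lo) ⟩
    #select p lo T + ((if p lo then 1 else 0) + 0)       ≡⟨ cong (#select p lo T +_) (+-identityʳ _) ⟩
    #select p lo T + (if p lo then 1 else 0)             ≡⟨ +-comm _ (if p lo then 1 else 0) ⟩
    (if p lo then 1 else 0) + #select p lo T             ∎)
    where open ≡-Reasoning

  #select-window : ∀ lo → #select p lo T ≡ #period
  #select-window zero = refl
  #select-window (suc lo) = trans (#select-shift lo) (#select-window lo)

  #select-periods : ∀ lo q → q * #period ≤ #select p lo (q * T)
  #select-periods lo zero = z≤n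
  #select-periods lo (suc q) = begin
    #period + q * #period                       ≤⟨ +-monoʳ-≤ #period (#select-periods (lo + T) q) ⟩
    #period + #select p (lo + T) (q * T)        ≡⟨ cong (_+ #select p (lo + T) (q * T)) (#select-window lo) ⟨
    #select p lo T + #select p (lo + T) (q * T) ≡⟨ #select-+ p lo T (q * T) ⟨
    #select p lo (T + q * T)                    ∎
    where open ≤-Reasoning

  #select-≥ : ∀ lo len → #period * len ≤ T * #select p lo len + #period * T
  #select-≥ lo len = begin
    #period * len                              ≡⟨ cong (#period *_) len≡ ⟩
    #period * (r + q * T)                      ≡⟨ rearrange #period r q T ⟩
    T * (q * #period) + #period * r            ≤⟨ +-mono-≤ (*-monoʳ-≤ T (#select-periods lo q))
                                                           (*-monoʳ-≤ #period (<⇒≤ (m%n<n len T))) ⟩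
    T * #select p lo (q * T) + #period * T     ≤⟨ +-monoˡ-≤ _ (*-monoʳ-≤ T (#select-mono p lo (q * T) r)) ⟩
    T * #select p lo (q * T + r) + #period * T ≡⟨ cong (λ l → T * #select p lo l + #period * T)
                                                       (trans (+-comm (q * T) r) (sym len≡)) ⟩
    T * #select p lo len + #period * T         ∎
    where
    open ≤-Reasoning
    q = len / T
    r = len % T
    len≡ : len ≡ r + q * T
    len≡ = m≡m%n+[m/n]*n len T
    rearrange : ∀ c r q T → c * (r + q * T) ≡ T * (q * c) + c * r
    rearrange = solve-∀

  -- The window (n/Q, n/P] holds at least (#period/T)·n·(1/P - 1/Q) - O(1) points of p.
  #select-between : ∀ n P Q .{{_ : NonZero P}} .{{_ : NonZero Q}} → P ≤ Q →
    #period * n * Q ≤ #period * n * P + (T * #select p (suc (n / Q)) (n / P ∸ n / Q) + #period * T + #period) * (P * Q)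
  #select-between n P Q P≤Q = begin
    c * n * Q                                           ≤⟨ *-monoˡ-≤ Q (*-monoʳ-≤ c (<⇒≤ (n<[n/d+1]*d n P))) ⟩
    c * (suc hi * P) * Q                                ≡⟨ cong (λ h → c * (suc h * P) * Q) hi≡lo+d ⟩
    c * (suc (lo + d) * P) * Q                          ≡⟨ expand c lo d P Q ⟩
    c * d * (P * Q) + c * (lo * Q) * P + c * (P * Q)    ≤⟨ +-monoˡ-≤ (c * (P * Q)) (+-mono-≤
                                                             (*-monoˡ-≤ (P * Q) (#select-≥ (suc lo) d))
                                                             (*-monoˡ-≤ P (*-monoʳ-≤ c (m/n*n≤m n Q)))) ⟩
    (T * w + c * T) * (P * Q) + c * n * P + c * (P * Q) ≡⟨ collect c n w T P Q ⟩
    c * n * P + (T * w + c * T + c) * (P * Q)           ∎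
    where
    open ≤-Reasoning
    c = #period
    lo = n / Q
    hi = n / P
    d = hi ∸ lo
    w = #select p (suc lo) d
    hi≡lo+d : hi ≡ lo + d
    hi≡lo+d = sym (m+[n∸m]≡n (/-monoʳ-≤ n P≤Q))
    expand : ∀ c lo d P Q → c * (suc (lo + d) * P) * Q ≡ c * d * (P * Q) + c * (lo * Q) * P + c * (P * Q)
    expand = solve-∀
    collect : ∀ c n w T P Q →
      (T * w + c * T) * (P * Q) + c * n * P + c * (P * Q) ≡ c * n * P + (T * w + c * T + c) * (P * Q)
    collect = solve-∀

-- Geometric progressions

geom : ℕ → ℕ → ℕ → ℕ → ℕ → ℕ
geom k r s a i = a * r ^ (k ∸ 1 ∸ i) * s ^ i

geom-ratio : ∀ k r s a i → suc i < k → r * geom k r s a (suc i) ≡ s * geom k r s a i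
geom-ratio k r s a i i+1<k rewrite [k∸1]∸i≡suc k i i+1<k = swap r s a (r ^ (k ∸ 1 ∸ suc i)) (s ^ i)
  where swap : ∀ r s a x y → r * (a * x * (s * y)) ≡ s * (a * (r * x) * y)
        swap = solve-∀

geom-pos : ∀ k r s a i .{{_ : NonZero r}} .{{_ : NonZero s}} → 0 < a → 0 < geom k r s a i
geom-pos k r s a i 0<a = *-pos (*-pos 0<a (m^n>0 r (k ∸ 1 ∸ i))) (m^n>0 s i)

geom-≥ : ∀ k r s a i → r ≤ s → i < k → a * r ^ (k ∸ 1) ≤ geom k r s a i
geom-≥ k r s a i r≤s i<k = begin
  a * r ^ (k ∸ 1)                 ≡⟨ cong (λ e → a * r ^ e) ([k∸1]∸i+i≡k∸1 k i i<k) ⟨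
  a * r ^ (k ∸ 1 ∸ i + i)         ≡⟨ cong (a *_) (^-distribˡ-+-* r (k ∸ 1 ∸ i) i) ⟩
  a * (r ^ (k ∸ 1 ∸ i) * r ^ i)   ≡⟨ *-assoc a _ _ ⟨
  a * r ^ (k ∸ 1 ∸ i) * r ^ i     ≤⟨ *-monoʳ-≤ (a * r ^ (k ∸ 1 ∸ i)) (^-monoˡ-≤ i r≤s) ⟩
  geom k r s a i                  ∎
  where open ≤-Reasoning

geom-≤ : ∀ k r s a i → r ≤ s → i < k → geom k r s a i ≤ a * s ^ (k ∸ 1)
geom-≤ k r s a i r≤s i<k = begin
  a * r ^ (k ∸ 1 ∸ i) * s ^ i     ≤⟨ *-monoˡ-≤ (s ^ i) (*-monoʳ-≤ a (^-monoˡ-≤ (k ∸ 1 ∸ i) r≤s)) ⟩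
  a * s ^ (k ∸ 1 ∸ i) * s ^ i     ≡⟨ *-assoc a _ _ ⟩
  a * (s ^ (k ∸ 1 ∸ i) * s ^ i)   ≡⟨ cong (a *_) (^-distribˡ-+-* s (k ∸ 1 ∸ i) i) ⟨
  a * s ^ (k ∸ 1 ∸ i + i)         ≡⟨ cong (λ e → a * s ^ e) ([k∸1]∸i+i≡k∸1 k i i<k) ⟩
  a * s ^ (k ∸ 1)                 ∎
  where open ≤-Reasoning

geom-≥-* : ∀ k r s a i t → r ≤ s → i < k → a * (r * t) ^ (k ∸ 1) ≤ geom k r s a i * t ^ (k ∸ 1)
geom-≥-* k r s a i t r≤s i<k = begin
  a * (r * t) ^ (k ∸ 1)             ≡⟨ cong (a *_) ([m*n]^e≡m^e*n^e r t (k ∸ 1)) ⟩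
  a * (r ^ (k ∸ 1) * t ^ (k ∸ 1))   ≡⟨ *-assoc a _ _ ⟨
  a * r ^ (k ∸ 1) * t ^ (k ∸ 1)     ≤⟨ *-monoˡ-≤ (t ^ (k ∸ 1)) (geom-≥ k r s a i r≤s i<k) ⟩
  geom k r s a i * t ^ (k ∸ 1)      ∎
  where open ≤-Reasoning

∤-geom : ∀ {p} k r s a i → Prime p → ¬ p ∣ r → ¬ p ∣ s → ¬ p ∣ a → ¬ p ∣ geom k r s a i
∤-geom k r s a i pr p∤r p∤s p∤a =
  ∤-* _ _ pr (∤-* a _ pr p∤a (∤-^ r (k ∸ 1 ∸ i) pr p∤r)) (∤-^ s i pr p∤s)

geom-injectiveʳ : ∀ {p} k r a a′ i i′ .{{_ : NonZero r}} → Prime p → ¬ p ∣ r → ¬ p ∣ a → ¬ p ∣ a′ →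
                  geom k r p a i ≡ geom k r p a′ i′ → a ≡ a′
geom-injectiveʳ {p} k r a a′ i i′ pr p∤r p∤a p∤a′ eq
  with ^-*-injective p i i′ (a * r ^ (k ∸ 1 ∸ i)) (a′ * r ^ (k ∸ 1 ∸ i′)) {{prime⇒nonZero pr}}
         (∤-* a _ pr p∤a (∤-^ r (k ∸ 1 ∸ i) pr p∤r)) (∤-* a′ _ pr p∤a′ (∤-^ r (k ∸ 1 ∸ i′) pr p∤r))
         (trans (*-comm (p ^ i) _) (trans eq (*-comm _ (p ^ i′))))
... | refl , eq′ = *-cancelʳ-≡ a a′ (r ^ (k ∸ 1 ∸ i)) {{m^n≢0 r (k ∸ 1 ∸ i)}} eq′

geom-injectiveˡ : ∀ {p} k s a a′ i i′ .{{_ : NonZero s}} → Prime p → ¬ p ∣ s → ¬ p ∣ a → ¬ p ∣ a′ →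
                  i < k → i′ < k → geom k p s a i ≡ geom k p s a′ i′ → a ≡ a′
geom-injectiveˡ {p} k s a a′ i i′ pr p∤s p∤a p∤a′ i<k i′<k eq
  with ^-*-injective p (k ∸ 1 ∸ i) (k ∸ 1 ∸ i′) (a * s ^ i) (a′ * s ^ i′) {{prime⇒nonZero pr}}
         (∤-* a _ pr p∤a (∤-^ s i pr p∤s)) (∤-* a′ _ pr p∤a′ (∤-^ s i′ pr p∤s))
         (trans (rotate a (p ^ (k ∸ 1 ∸ i)) (s ^ i)) (trans eq (sym (rotate a′ (p ^ (k ∸ 1 ∸ i′)) (s ^ i′)))))
  where rotate : ∀ a x y → x * (a * y) ≡ a * x * y
        rotate = solve-∀
... | x≡x′ , eq′ with +-cancelˡ-≡ (k ∸ 1 ∸ i) i i′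
                        (trans ([k∸1]∸i+i≡k∸1 k i i<k) (trans (sym ([k∸1]∸i+i≡k∸1 k i′ i′<k)) (cong (_+ i′) (sym x≡x′))))
... | refl = *-cancelʳ-≡ a a′ (s ^ i) {{m^n≢0 s i}} eq′

-- A common term is prime to 3, forcing i = k - 1; comparing 5-adic valuations then gives j = 0 and a = b.
geom-3-5≢geom-5-7 : ∀ k a b i j → i < k → j < k → ¬ 5 ∣ a → ¬ 3 ∣ b → ¬ 5 ∣ b → b < a →
                    geom k 3 5 a i ≢ geom k 5 7 b j
geom-3-5≢geom-5-7 k a b i j i<k j<k 5∤a 3∤b 5∤b b<a eq with k ∸ 1 ∸ i in e
... | suc t = ∤-geom k 5 7 b j prime-3 (from-no (3 ∣? 5)) (from-no (3 ∣? 7)) 3∤b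
                (divides (a * 3 ^ t * 5 ^ i) (trans (sym eq) (pull-3 a (3 ^ t) (5 ^ i))))
  where pull-3 : ∀ a x y → a * (3 * x) * y ≡ a * x * y * 3
        pull-3 = solve-∀
... | zero with ^-*-injective 5 i (k ∸ 1 ∸ j) a (b * 7 ^ j) 5∤a (∤-* b (7 ^ j) prime-5 5∤b (∤-^ 7 j prime-5 (from-no (5 ∣? 7))))
                  (trans (rotate₁ a (5 ^ i)) (trans eq (rotate₂ b (5 ^ (k ∸ 1 ∸ j)) (7 ^ j))))
  where rotate₁ : ∀ a y → y * a ≡ a * 1 * y
        rotate₁ = solve-∀
        rotate₂ : ∀ b x y → b * x * y ≡ x * (b * y)
        rotate₂ = solve-∀
... | i≡ , a≡ = <-irrefl (trans (sym (*-identityʳ b)) (trans (cong (λ j → b * 7 ^ j) (sym j≡0)) (sym a≡))) b<a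
  where
  i≡k∸1 : i ≡ k ∸ 1
  i≡k∸1 = trans (sym (cong (_+ i) e)) ([k∸1]∸i+i≡k∸1 k i i<k)
  j≡0 : j ≡ 0
  j≡0 = +-cancelˡ-≡ (k ∸ 1 ∸ j) j 0 (trans ([k∸1]∸i+i≡k∸1 k j j<k) (trans (sym i≡k∸1) (trans i≡ (sym (+-identityʳ _)))))

geom-escapes : ∀ {A k} → ¬ ContainsGP k A → ∀ r s a .{{_ : NonZero r}} .{{_ : NonZero s}} → r ≢ s → 0 < a →
               ¬ (∀ i → i < k → A (geom k r s a i) ≡ true)
geom-escapes {k = k} no-gp r s a r≢s 0<a all-in-A = no-gp
  (geom k r s a , s , r , >-nonZero⁻¹ s , >-nonZero⁻¹ r , ≢-sym r≢s ,
   (λ i i<k → geom-pos k r s a i 0<a , all-in-A i i<k) , geom-ratio k r s a)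

Disjoint : ℕ → (ℕ → ℕ) → (ℕ → ℕ) → Set
Disjoint k g h = ∀ i j → i < k → j < k → g i ≢ h j

Disjoint-sym : ∀ {k g h} → Disjoint k g h → Disjoint k h g
Disjoint-sym disjoint i j i<k j<k = ≢-sym (disjoint j i j<k i<k)

AllPairs-map : ∀ {A B : Set} {P : A → Set} {R : A → A → Set} {S : B → B → Set} {f : A → B} {xs} →
               (∀ {x y} → P x → P y → R x y → S (f x) (f y)) → All P xs → AllPairs R xs → AllPairs S (map f xs)
AllPairs-map relate [] [] = []
AllPairs-map {f = f} relate (px ∷ pxs) (rx ∷ rxs) = map-head pxs rx ∷ AllPairs-map relate pxs rxs
  where
  map-head : ∀ {ys} → All _ ys → All _ ys → All _ (map f ys)
  map-head [] [] = []
  map-head (py ∷ pys) (r ∷ rs) = relate px py r ∷ map-head pys rs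

module Witness (A : Set⁺) (k : ℕ) where

  -- A term g i ∉ A with i < k if there is one, and the junk value 0 otherwise.
  missing : (ℕ → ℕ) → ℕ
  missing g with anyUpTo? (λ i → A (g i) Bool.≟ false) k
  ... | yes (i , _) = g i
  ... | no _ = 0

  missing-spec : ∀ g → ¬ (∀ i → i < k → A (g i) ≡ true) → ∃ λ i → i < k × missing g ≡ g i × A (g i) ≡ false
  missing-spec g not-all with anyUpTo? (λ i → A (g i) Bool.≟ false) k
  ... | yes (i , i<k , Agi≡false) = i , i<k , refl , Agi≡false
  ... | no none = ⊥-elim (not-all λ i i<k → Bool.¬-not (λ Agi≡false → none (i , i<k , Agi≡false)))

  Escaping : ℕ → (ℕ → ℕ) → Set
  Escaping n g = (∀ i → i < k → 1 ≤ g i × g i ≤ n) × ¬ (∀ i → i < k → A (g i) ≡ true)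

  missing-counted : ∀ {n g} → Escaping n g → Counted (not ∘ A) n (missing g)
  missing-counted {n} {g} (in-range , escapes) with missing-spec g escapes
  ... | i , i<k , missing≡ , Agi≡false rewrite missing≡ =
    proj₁ (in-range i i<k) , proj₂ (in-range i i<k) , cong not Agi≡false

  missing-≢ : ∀ {n g h} → Escaping n g → Escaping n h → Disjoint k g h → missing g ≢ missing h
  missing-≢ {g = g} {h} (_ , g-escapes) (_ , h-escapes) disjoint
    with missing-spec g g-escapes | missing-spec h h-escapes
  ... | i , i<k , g≡ , _ | j , j<k , h≡ , _ = λ eq → disjoint i j i<k j<k (trans (sym g≡) (trans eq h≡))

  count+length≤ : ∀ n gs → All (Escaping n) gs → AllPairs (Disjoint k) gs → count A n + length gs ≤ n
  count+length≤ n gs escaping disjoint = begin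
    count A n + length gs                   ≡⟨ cong (count A n +_) (length-map missing gs) ⟨
    count A n + length (map missing gs)     ≤⟨ +-monoʳ-≤ (count A n) (length≤count (not ∘ A) n
                                                 (All.map⁺ (All.map missing-counted escaping))
                                                 (AllPairs-map missing-≢ escaping disjoint)) ⟩
    count A n + count (not ∘ A) n           ≡⟨ count-complement A n ⟩
    n                                       ∎
    where open ≤-Reasoning

-- Clearing denominators

ι : ℕ → ℚ
ι n = mkℚ (ℤ.+ n) 0 (Coprime.sym (1-coprimeTo n))

toℚᵘ-/ : ∀ a b .{{_ : NonZero b}} → toℚᵘ (ℤ.+ a ℚ./ b) ℚᵘ.≃ ℚᵘ.mkℚᵘ (ℤ.+ a) (pred b)
toℚᵘ-/ a (suc b) = ℚ.toℚᵘ-fromℚᵘ (ℚᵘ.mkℚᵘ (ℤ.+ a) b)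

ι-+ : ∀ m n → ι (m + n) ≡ ι m ℚ.+ ι n
ι-+ m n = ℚ.toℚᵘ-injective (ℚᵘ.≃-trans (ℚᵘ.*≡* (trans (cong (ℤ._* ℤ.+ 1) (ℤ.pos-+ m n)) (identity (ℤ.+ m) (ℤ.+ n))))
                                        (ℚᵘ.≃-sym (ℚ.toℚᵘ-homo-+ (ι m) (ι n))))
  where
  identity : ∀ x y → (x ℤ.+ y) ℤ.* ℤ.+ 1 ≡ (x ℤ.* ℤ.+ 1 ℤ.+ y ℤ.* ℤ.+ 1) ℤ.* ℤ.+ 1
  identity = ℤ.solve-∀

ι-mono-≤ : ∀ {m n} → m ≤ n → ι m ℚ.≤ ι n
ι-mono-≤ {m} {n} m≤n = ℚ.*≤* (subst₂ ℤ._≤_ (sym (ℤ.*-identityʳ (ℤ.+ m))) (sym (ℤ.*-identityʳ (ℤ.+ n))) (ℤ.+≤+ m≤n))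

/-*-ι : ∀ a b y .{{_ : NonZero b}} → (ℤ.+ a ℚ./ b) ℚ.* ι (b * y) ≡ ι (a * y)
/-*-ι a b@(suc b-1) y = ℚ.toℚᵘ-injective (ℚᵘ.≃-trans (ℚ.toℚᵘ-homo-* (ℤ.+ a ℚ./ b) (ι (b * y)))
  (ℚᵘ.≃-trans (ℚᵘ.*-congʳ (toℚᵘ-/ a b)) (ℚᵘ.*≡* cross-multiplied)))
  where
  cross-multiplied : (ℤ.+ a ℤ.* ℤ.+ (b * y)) ℤ.* ℤ.+ 1 ≡ ℤ.+ (a * y) ℤ.* ℤ.+ (b * 1)
  cross-multiplied = begin
    (ℤ.+ a ℤ.* ℤ.+ (b * y)) ℤ.* ℤ.+ 1 ≡⟨ cong (ℤ._* ℤ.+ 1) (ℤ.pos-* a (b * y)) ⟨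
    ℤ.+ (a * (b * y)) ℤ.* ℤ.+ 1       ≡⟨ ℤ.pos-* (a * (b * y)) 1 ⟨
    ℤ.+ (a * (b * y) * 1)             ≡⟨ cong ℤ.+_ (rearrange a b-1 y) ⟩
    ℤ.+ (a * y * (b * 1))             ≡⟨ ℤ.pos-* (a * y) (b * 1) ⟩
    ℤ.+ (a * y) ℤ.* ℤ.+ (b * 1)       ∎
    where
    open ≡-Reasoning
    rearrange : ∀ a b-1 y → a * (suc b-1 * y) * 1 ≡ a * y * (suc b-1 * 1)
    rearrange = solve-∀

inv-*-ι : ∀ b y → 0 < b * y → inv b ℚ.* ι (b * y) ≡ ι y
inv-*-ι (suc b) y _ = trans (/-*-ι 1 (suc b) y) (cong ι (*-identityˡ y))

/-*-inv-*-ι : ∀ a b d y .{{_ : NonZero b}} → 0 < d * (b * y) → (ℤ.+ a ℚ./ b ℚ.* inv d) ℚ.* ι (d * (b * y)) ≡ ι (a * y)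
/-*-inv-*-ι a b d y 0<D = begin
  (ℤ.+ a ℚ./ b ℚ.* inv d) ℚ.* ι (d * (b * y)) ≡⟨ ℚ.*-assoc (ℤ.+ a ℚ./ b) (inv d) _ ⟩
  ℤ.+ a ℚ./ b ℚ.* (inv d ℚ.* ι (d * (b * y))) ≡⟨ cong (ℤ.+ a ℚ./ b ℚ.*_) (inv-*-ι d (b * y) 0<D) ⟩
  ℤ.+ a ℚ./ b ℚ.* ι (b * y)                   ≡⟨ /-*-ι a b y ⟩
  ι (a * y)                                   ∎
  where open ≡-Reasoning

*-ι-+ : ∀ x y {a b} D → x ℚ.* ι D ≡ ι a → y ℚ.* ι D ≡ ι b → (x ℚ.+ y) ℚ.* ι D ≡ ι (a + b)
*-ι-+ x y {a} {b} D x·D≡a y·D≡b = begin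
  (x ℚ.+ y) ℚ.* ι D         ≡⟨ ℚ.*-distribʳ-+ (ι D) x y ⟩
  x ℚ.* ι D ℚ.+ y ℚ.* ι D   ≡⟨ cong₂ ℚ._+_ x·D≡a y·D≡b ⟩
  ι a ℚ.+ ι b               ≡⟨ ι-+ a b ⟨
  ι (a + b)                 ∎
  where open ≡-Reasoning

*-ι-cancel-≤ : ∀ {x y a b D} → 0 < D → x ℚ.* ι D ≡ ι a → y ℚ.* ι D ≡ ι b → a ≤ b → x ℚ.≤ y
*-ι-cancel-≤ {D = suc d} _ x·D≡a y·D≡b a≤b =
  ℚ.*-cancelʳ-≤-pos (ι (suc d)) (subst₂ ℚ._≤_ (sym x·D≡a) (sym y·D≡b) (ι-mono-≤ a≤b))
≤-by-common-multiple :
  ∀ c n K P Q R S E {X₁ X₂ X₃ X₄ X₅ X₆ X₇} D .{{_ : NonZero n}} → 0 < D →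
  D ≡ n * X₁ → D ≡ K * X₂ → D ≡ P * (5 * X₃) → D ≡ R * (15 * X₄) →
  D ≡ Q * (5 * X₅) → D ≡ S * (15 * X₆) → D ≡ E * X₇ →
  c * X₁ + (X₂ + 2 * X₃ + 4 * X₄) ≤ D + 2 * X₅ + 4 * X₆ + X₇ →
  ℤ.+ c ℚ./ n ℚ.≤ 1ℚ ℚ.- inv K ℚ.- (ℤ.+ 2 ℚ./ 5) ℚ.* (inv P ℚ.- inv Q) ℚ.- (ℤ.+ 4 ℚ./ 15) ℚ.* (inv R ℚ.- inv S) ℚ.+ inv E
≤-by-common-multiple c n K P Q R S E {X₁} {X₂} {X₃} {X₄} {X₅} {X₆} {X₇} D 0<D e₁ e₂ e₃ e₄ e₅ e₆ e₇ cleared =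
  subst₂ ℚ._≤_ (cancel (ℤ.+ c ℚ./ n) lower) (rearrange 1ℚ (inv K) (inv P) (inv Q) (inv R) (inv S) (inv E) r₂ r₄)
    (ℚ.+-monoˡ-≤ (ℚ.- lower) {ℤ.+ c ℚ./ n ℚ.+ lower} {upper} (*-ι-cancel-≤ 0<D lhs rhs cleared))
  where
  open +-*-Solver
  r₂ r₄ lower upper : ℚ
  r₂ = ℤ.+ 2 ℚ./ 5
  r₄ = ℤ.+ 4 ℚ./ 15
  lower = inv K ℚ.+ r₂ ℚ.* inv P ℚ.+ r₄ ℚ.* inv R
  upper = 1ℚ ℚ.+ r₂ ℚ.* inv Q ℚ.+ r₄ ℚ.* inv S ℚ.+ inv E
  at : ∀ x {a D′} → D ≡ D′ → x ℚ.* ι D′ ≡ ι a → x ℚ.* ι D ≡ ι a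
  at x D≡D′ x·D′≡a = trans (cong (λ z → x ℚ.* ι z) D≡D′) x·D′≡a
  0<[_] : ∀ {D′} → D ≡ D′ → 0 < D′
  0<[ D≡D′ ] = subst (0 <_) D≡D′ 0<D
  lhs : (ℤ.+ c ℚ./ n ℚ.+ lower) ℚ.* ι D ≡ ι (c * X₁ + (X₂ + 2 * X₃ + 4 * X₄))
  lhs = *-ι-+ (ℤ.+ c ℚ./ n) lower D (at (ℤ.+ c ℚ./ n) e₁ (/-*-ι c n X₁))
          (*-ι-+ (inv K ℚ.+ r₂ ℚ.* inv P) (r₄ ℚ.* inv R) D
            (*-ι-+ (inv K) (r₂ ℚ.* inv P) D (at (inv K) e₂ (inv-*-ι K X₂ 0<[ e₂ ]))
                                           (at (r₂ ℚ.* inv P) e₃ (/-*-inv-*-ι 2 5 P X₃ 0<[ e₃ ])))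
            (at (r₄ ℚ.* inv R) e₄ (/-*-inv-*-ι 4 15 R X₄ 0<[ e₄ ])))
  rhs : upper ℚ.* ι D ≡ ι (D + 2 * X₅ + 4 * X₆ + X₇)
  rhs = *-ι-+ (1ℚ ℚ.+ r₂ ℚ.* inv Q ℚ.+ r₄ ℚ.* inv S) (inv E) D
          (*-ι-+ (1ℚ ℚ.+ r₂ ℚ.* inv Q) (r₄ ℚ.* inv S) D
            (*-ι-+ 1ℚ (r₂ ℚ.* inv Q) D (ℚ.*-identityˡ (ι D))
                                      (at (r₂ ℚ.* inv Q) e₅ (/-*-inv-*-ι 2 5 Q X₅ 0<[ e₅ ])))
            (at (r₄ ℚ.* inv S) e₆ (/-*-inv-*-ι 4 15 S X₆ 0<[ e₆ ])))
          (at (inv E) e₇ (inv-*-ι E X₇ 0<[ e₇ ]))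
  cancel : ∀ x t → x ℚ.+ t ℚ.- t ≡ x
  cancel = solve 2 (λ x t → x :+ t :- t := x) refl
  rearrange : ∀ one iK iP iQ iR iS iE r₂ r₄ →
    (one ℚ.+ r₂ ℚ.* iQ ℚ.+ r₄ ℚ.* iS ℚ.+ iE) ℚ.- (iK ℚ.+ r₂ ℚ.* iP ℚ.+ r₄ ℚ.* iR)
      ≡ one ℚ.- iK ℚ.- r₂ ℚ.* (iP ℚ.- iQ) ℚ.- r₄ ℚ.* (iR ℚ.- iS) ℚ.+ iE
  rearrange = solve 9 (λ one iK iP iQ iR iS iE r₂ r₄ →
    (one :+ r₂ :* iQ :+ r₄ :* iS :+ iE) :- (iK :+ r₂ :* iP :+ r₄ :* iR)
      := one :- iK :- r₂ :* (iP :- iQ) :- r₄ :* (iR :- iS) :+ iE) refl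

cleared⇒≤ :
  ∀ c n K P Q R S E .{{_ : NonZero n}} .{{_ : NonZero K}} .{{_ : NonZero P}} .{{_ : NonZero Q}}
    .{{_ : NonZero R}} .{{_ : NonZero S}} .{{_ : NonZero E}} →
  c * (30 * K * P * Q * R * S * E) + (30 * P * Q * R * S * E * n + 2 * (6 * K * Q * R * S * E * n) + 4 * (2 * K * P * Q * S * E * n))
    ≤ 30 * K * P * Q * R * S * E * n + 2 * (6 * K * P * R * S * E * n) + 4 * (2 * K * P * Q * R * E * n) + 30 * K * P * Q * R * S * n →
  ℤ.+ c ℚ./ n ℚ.≤ 1ℚ ℚ.- inv K ℚ.- (ℤ.+ 2 ℚ./ 5) ℚ.* (inv P ℚ.- inv Q) ℚ.- (ℤ.+ 4 ℚ./ 15) ℚ.* (inv R ℚ.- inv S) ℚ.+ inv E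
cleared⇒≤ c n K P Q R S E = ≤-by-common-multiple c n K P Q R S E
  {30 * K * P * Q * R * S * E} {30 * P * Q * R * S * E * n} {6 * K * Q * R * S * E * n} {2 * K * P * Q * S * E * n}
  {6 * K * P * R * S * E * n} {2 * K * P * Q * R * E * n} {30 * K * P * Q * R * S * n} (30 * K * P * Q * R * S * E * n) 0<D
  (factor₁ K P Q R S E n) (factor₂ K P Q R S E n) (factor₃ K P Q R S E n) (factor₄ K P Q R S E n)
  (factor₅ K P Q R S E n) (factor₆ K P Q R S E n) (factor₇ K P Q R S E n)
  where
  0<D : 0 < 30 * K * P * Q * R * S * E * n
  0<D = *-pos (*-pos (*-pos (*-pos (*-pos (*-pos (*-pos {30} (s≤s z≤n) (>-nonZero⁻¹ K)) (>-nonZero⁻¹ P))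
          (>-nonZero⁻¹ Q)) (>-nonZero⁻¹ R)) (>-nonZero⁻¹ S)) (>-nonZero⁻¹ E)) (>-nonZero⁻¹ n)
  factor₁ : ∀ K P Q R S E n → 30 * K * P * Q * R * S * E * n ≡ n * (30 * K * P * Q * R * S * E)
  factor₁ = solve-∀
  factor₂ : ∀ K P Q R S E n → 30 * K * P * Q * R * S * E * n ≡ K * (30 * P * Q * R * S * E * n)
  factor₂ = solve-∀
  factor₃ : ∀ K P Q R S E n → 30 * K * P * Q * R * S * E * n ≡ P * (5 * (6 * K * Q * R * S * E * n))
  factor₃ = solve-∀
  factor₄ : ∀ K P Q R S E n → 30 * K * P * Q * R * S * E * n ≡ R * (15 * (2 * K * P * Q * S * E * n))
  factor₄ = solve-∀
  factor₅ : ∀ K P Q R S E n → 30 * K * P * Q * R * S * E * n ≡ Q * (5 * (6 * K * P * R * S * E * n))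
  factor₅ = solve-∀
  factor₆ : ∀ K P Q R S E n → 30 * K * P * Q * R * S * E * n ≡ S * (15 * (2 * K * P * Q * R * E * n))
  factor₆ = solve-∀
  factor₇ : ∀ K P Q R S E n → 30 * K * P * Q * R * S * E * n ≡ E * (30 * K * P * Q * R * S * n)
  factor₇ = solve-∀

inv-↧ₙ≤ : ∀ ε → 0ℚ ℚ.< ε → inv (ℚ.↧ₙ ε) ℚ.≤ ε
inv-↧ₙ≤ (mkℚ (ℤ.+ suc p) d _) _ = ℚ.toℚᵘ-cancel-≤ (ℚᵘ.≤-respˡ-≃ (ℚᵘ.≃-sym (toℚᵘ-/ 1 (suc d)))
  (ℚᵘ.*≤* (ℤ.+≤+ (*-monoˡ-≤ (suc d) {1} {suc p} (s≤s z≤n)))))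
inv-↧ₙ≤ (mkℚ (ℤ.+ zero) d _) (ℚ.*<* (ℤ.+<+ ()))
inv-↧ₙ≤ (mkℚ ℤ.-[1+ p ] d _) (ℚ.*<* ())

module Assembly (c n K G W c₂ c₃ P Q R S E J : ℕ)
  (count≤ : c + (W + c₂ + c₃) ≤ n + J)
  (twos≤ : n * G ≤ K * G * W + n)
  (G-large : 2 * E ≤ K * G)
  (fiveThirds≤ : 4 * n * Q ≤ 4 * n * P + (10 * c₂ + 40 + 4) * (P * Q))
  (sevenFifths≤ : 8 * n * S ≤ 8 * n * R + (30 * c₃ + 240 + 8) * (R * S))
  (n-large : 2 * E * (J + 14) ≤ n) where

  twos≤′ : .{{_ : NonZero G}} → 2 * E * n ≤ 2 * E * K * W + K * n
  twos≤′ = *-cancelˡ-≤ G (begin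
    G * (2 * E * n)                 ≡⟨ swap G E n ⟩
    2 * E * (n * G)                 ≤⟨ *-monoʳ-≤ (2 * E) twos≤ ⟩
    2 * E * (K * G * W + n)         ≡⟨ *-distribˡ-+ (2 * E) _ n ⟩
    2 * E * (K * G * W) + 2 * E * n ≤⟨ +-monoʳ-≤ (2 * E * (K * G * W)) (*-monoˡ-≤ n G-large) ⟩
    2 * E * (K * G * W) + K * G * n ≡⟨ factor E K G W n ⟩
    G * (2 * E * K * W + K * n)     ∎)
    where
    open ≤-Reasoning
    swap : ∀ G E n → G * (2 * E * n) ≡ 2 * E * (n * G)
    swap = solve-∀
    factor : ∀ E K G W n → 2 * E * (K * G * W) + K * G * n ≡ G * (2 * E * K * W + K * n)
    factor = solve-∀

  families-weighted : .{{_ : NonZero G}} →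
    c * (30 * K * P * Q * R * S * E) + (30 * P * Q * R * S * E * n + 2 * (6 * K * Q * R * S * E * n) + 4 * (2 * K * P * Q * S * E * n))
      ≤ 30 * (K * P * Q * R * S * E) * (c + (W + c₂ + c₃))
        + (15 * K * P * Q * R * S * n + 12 * K * P * R * S * E * n + 8 * K * P * Q * R * E * n + 380 * (K * P * Q * R * S * E))
  families-weighted = begin
    c * (30 * K * P * Q * R * S * E) + (30 * P * Q * R * S * E * n + 2 * (6 * K * Q * R * S * E * n) + 4 * (2 * K * P * Q * S * E * n))
      ≡⟨ split c n K P Q R S E ⟩
    30 * (K * P * Q * R * S * E) * c + 15 * (P * Q * R * S) * (2 * E * n) + 3 * K * R * S * E * (4 * n * Q) + K * P * Q * E * (8 * n * S)
      ≤⟨ +-mono-≤ (+-mono-≤ (+-monoʳ-≤ _ (*-monoʳ-≤ (15 * (P * Q * R * S)) twos≤′))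
                            (*-monoʳ-≤ (3 * K * R * S * E) fiveThirds≤))
                  (*-monoʳ-≤ (K * P * Q * E) sevenFifths≤) ⟩
    30 * (K * P * Q * R * S * E) * c + 15 * (P * Q * R * S) * (2 * E * K * W + K * n)
      + 3 * K * R * S * E * (4 * n * P + (10 * c₂ + 40 + 4) * (P * Q)) + K * P * Q * E * (8 * n * R + (30 * c₃ + 240 + 8) * (R * S))
      ≡⟨ regroup c n K W c₂ c₃ P Q R S E ⟩
    30 * (K * P * Q * R * S * E) * (c + (W + c₂ + c₃))
      + (15 * K * P * Q * R * S * n + 12 * K * P * R * S * E * n + 8 * K * P * Q * R * E * n + 380 * (K * P * Q * R * S * E)) ∎
    where
    open ≤-Reasoning
    split : ∀ c n K P Q R S E →
      c * (30 * K * P * Q * R * S * E) + (30 * P * Q * R * S * E * n + 2 * (6 * K * Q * R * S * E * n) + 4 * (2 * K * P * Q * S * E * n))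
        ≡ 30 * (K * P * Q * R * S * E) * c + 15 * (P * Q * R * S) * (2 * E * n) + 3 * K * R * S * E * (4 * n * Q) + K * P * Q * E * (8 * n * S)
    split = solve-∀
    regroup : ∀ c n K W c₂ c₃ P Q R S E →
      30 * (K * P * Q * R * S * E) * c + 15 * (P * Q * R * S) * (2 * E * K * W + K * n)
        + 3 * K * R * S * E * (4 * n * P + (10 * c₂ + 40 + 4) * (P * Q)) + K * P * Q * E * (8 * n * R + (30 * c₃ + 240 + 8) * (R * S))
        ≡ 30 * (K * P * Q * R * S * E) * (c + (W + c₂ + c₃))
          + (15 * K * P * Q * R * S * n + 12 * K * P * R * S * E * n + 8 * K * P * Q * R * E * n + 380 * (K * P * Q * R * S * E))
    regroup = solve-∀

  cleared : .{{_ : NonZero G}} →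
    c * (30 * K * P * Q * R * S * E) + (30 * P * Q * R * S * E * n + 2 * (6 * K * Q * R * S * E * n) + 4 * (2 * K * P * Q * S * E * n))
      ≤ 30 * K * P * Q * R * S * E * n + 2 * (6 * K * P * R * S * E * n) + 4 * (2 * K * P * Q * R * E * n) + 30 * K * P * Q * R * S * n
  cleared = begin
    c * (30 * K * P * Q * R * S * E) + (30 * P * Q * R * S * E * n + 2 * (6 * K * Q * R * S * E * n) + 4 * (2 * K * P * Q * S * E * n))
      ≤⟨ families-weighted ⟩
    30 * (K * P * Q * R * S * E) * (c + (W + c₂ + c₃)) + rest
      ≤⟨ +-monoˡ-≤ rest (*-monoʳ-≤ (30 * (K * P * Q * R * S * E)) count≤) ⟩
    30 * (K * P * Q * R * S * E) * (n + J) + rest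
      ≤⟨ m≤m+n _ (40 * (K * P * Q * R * S * E)) ⟩
    30 * (K * P * Q * R * S * E) * (n + J) + rest + 40 * (K * P * Q * R * S * E)
      ≡⟨ isolate-J n K P Q R S E J ⟩
    30 * K * P * Q * R * S * E * n + 15 * K * P * Q * R * S * n + 12 * K * P * R * S * E * n + 8 * K * P * Q * R * E * n
      + 15 * K * P * Q * R * S * (2 * E * (J + 14))
      ≤⟨ +-monoʳ-≤ _ (*-monoʳ-≤ (15 * K * P * Q * R * S) n-large) ⟩
    30 * K * P * Q * R * S * E * n + 15 * K * P * Q * R * S * n + 12 * K * P * R * S * E * n + 8 * K * P * Q * R * E * n
      + 15 * K * P * Q * R * S * n
      ≡⟨ collect n K P Q R S E ⟩
    30 * K * P * Q * R * S * E * n + 2 * (6 * K * P * R * S * E * n) + 4 * (2 * K * P * Q * R * E * n) + 30 * K * P * Q * R * S * n ∎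
    where
    open ≤-Reasoning
    rest = 15 * K * P * Q * R * S * n + 12 * K * P * R * S * E * n + 8 * K * P * Q * R * E * n + 380 * (K * P * Q * R * S * E)
    isolate-J : ∀ n K P Q R S E J →
      30 * (K * P * Q * R * S * E) * (n + J)
        + (15 * K * P * Q * R * S * n + 12 * K * P * R * S * E * n + 8 * K * P * Q * R * E * n + 380 * (K * P * Q * R * S * E))
        + 40 * (K * P * Q * R * S * E)
        ≡ 30 * K * P * Q * R * S * E * n + 15 * K * P * Q * R * S * n + 12 * K * P * R * S * E * n + 8 * K * P * Q * R * E * n
          + 15 * K * P * Q * R * S * (2 * E * (J + 14))
    isolate-J = solve-∀
    collect : ∀ n K P Q R S E →
      30 * K * P * Q * R * S * E * n + 15 * K * P * Q * R * S * n + 12 * K * P * R * S * E * n + 8 * K * P * Q * R * E * n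
        + 15 * K * P * Q * R * S * n
        ≡ 30 * K * P * Q * R * S * E * n + 2 * (6 * K * P * R * S * E * n) + 4 * (2 * K * P * Q * R * E * n) + 30 * K * P * Q * R * S * n
    collect = solve-∀

-- The three families

module Families (k : ℕ) .{{_ : NonZero k}} (n : ℕ) where

  T : ℕ → ℕ
  T j = 2 ^ (j * k + (k ∸ 1))

  T≢0 : ∀ j → NonZero (T j)
  T≢0 j = m^n≢0 2 (j * k + (k ∸ 1))

  2≤2^k : 2 ≤ 2 ^ k
  2≤2^k = ^-monoʳ-≤ 2 {1} {k} (>-nonZero⁻¹ k)

  instance
    K≢0 : NonZero (2 ^ k ∸ 1)
    K≢0 = >-nonZero (∸-monoˡ-≤ 1 2≤2^k)
    5^≢0 : NonZero (5 ^ (k ∸ 1))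
    5^≢0 = m^n≢0 5 (k ∸ 1)
    6^≢0 : NonZero (6 ^ (k ∸ 1))
    6^≢0 = m^n≢0 6 (k ∸ 1)
    7^≢0 : NonZero (7 ^ (k ∸ 1))
    7^≢0 = m^n≢0 7 (k ∸ 1)
    10^≢0 : NonZero (10 ^ (k ∸ 1))
    10^≢0 = m^n≢0 10 (k ∸ 1)

  X : ℕ → ℕ
  X j = (n / T j) {{T≢0 j}}

  lo₂ hi₂ lo₃ hi₃ : ℕ
  lo₂ = n / 6 ^ (k ∸ 1)
  hi₂ = n / 5 ^ (k ∸ 1)
  lo₃ = n / 10 ^ (k ∸ 1)
  hi₃ = n / 7 ^ (k ∸ 1)

  -- Progressions are named by labels so that disjointness becomes distinctness of valid labels.
  data Label : Set where
    two : ℕ → ℕ → Label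
    fiveThirds sevenFifths : ℕ → Label

  progression : Label → ℕ → ℕ
  progression (two j m) = geom k 1 2 (m * 2 ^ (j * k))
  progression (fiveThirds a) = geom k 3 5 a
  progression (sevenFifths a) = geom k 5 7 a

  Valid : Label → Set
  Valid (two j m) = odd m ≡ true × m ≤ X j
  Valid (fiveThirds a) = coprime-10 a ≡ true × lo₂ < a × a ≤ hi₂
  Valid (sevenFifths a) = coprime-30 a ≡ true × lo₃ < a × a ≤ hi₃

  two≡ : ∀ j m i → progression (two j m) i ≡ 2 ^ (j * k + i) * m
  two≡ j m i = begin
    m * 2 ^ (j * k) * 1 ^ (k ∸ 1 ∸ i) * 2 ^ i ≡⟨ cong (λ y → m * 2 ^ (j * k) * y * 2 ^ i) (^-zeroˡ (k ∸ 1 ∸ i)) ⟩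
    m * 2 ^ (j * k) * 1 * 2 ^ i             ≡⟨ rearrange m (2 ^ (j * k)) (2 ^ i) ⟩
    2 ^ (j * k) * 2 ^ i * m                 ≡⟨ cong (_* m) (^-distribˡ-+-* 2 (j * k) i) ⟨
    2 ^ (j * k + i) * m                     ∎
    where
    open ≡-Reasoning
    rearrange : ∀ m x y → m * x * 1 * y ≡ x * y * m
    rearrange = solve-∀

  valid-in-range : ∀ l → Valid l → ∀ i → i < k → 1 ≤ progression l i × progression l i ≤ n
  valid-in-range (two j m) (odd-m , m≤X) i i<k =
    geom-pos k 1 2 (m * 2 ^ (j * k)) i (*-pos (odd⇒pos m odd-m) (m^n>0 2 (j * k))) ,
    (begin
      geom k 1 2 (m * 2 ^ (j * k)) i      ≤⟨ geom-≤ k 1 2 (m * 2 ^ (j * k)) i (s≤s z≤n) i<k ⟩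
      m * 2 ^ (j * k) * 2 ^ (k ∸ 1)       ≡⟨ *-assoc m _ _ ⟩
      m * (2 ^ (j * k) * 2 ^ (k ∸ 1))     ≡⟨ cong (m *_) (^-distribˡ-+-* 2 (j * k) (k ∸ 1)) ⟨
      m * T j                             ≤⟨ ≤/⇒*≤ n (T j) {{T≢0 j}} m≤X ⟩
      n                                   ∎)
    where open ≤-Reasoning
  valid-in-range (fiveThirds a) (coprime , _ , a≤hi) i i<k =
    geom-pos k 3 5 a i (odd⇒pos a (coprime-10⇒odd a coprime)) ,
    ≤-trans (geom-≤ k 3 5 a i (s≤s (s≤s (s≤s z≤n))) i<k) (≤/⇒*≤ n _ a≤hi)
  valid-in-range (sevenFifths a) (coprime , _ , a≤hi) i i<k =
    geom-pos k 5 7 a i (odd⇒pos a (coprime-10⇒odd a (coprime-30⇒coprime-10 a coprime))) ,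
    ≤-trans (geom-≤ k 5 7 a i (s≤s (s≤s (s≤s (s≤s (s≤s z≤n))))) i<k) (≤/⇒*≤ n _ a≤hi)

  valid-escaping : ∀ {A} → ¬ ContainsGP k A → ∀ l → Valid l → Witness.Escaping A k n (progression l)
  valid-escaping {A} no-gp (two j m) v@(odd-m , _) =
    valid-in-range (two j m) v , geom-escapes {A} no-gp 1 2 _ (λ ()) (*-pos (odd⇒pos m odd-m) (m^n>0 2 (j * k)))
  valid-escaping {A} no-gp (fiveThirds a) v@(coprime , _) =
    valid-in-range (fiveThirds a) v , geom-escapes {A} no-gp 3 5 a (λ ()) (odd⇒pos a (coprime-10⇒odd a coprime))
  valid-escaping {A} no-gp (sevenFifths a) v@(coprime , _) =
    valid-in-range (sevenFifths a) v ,
    geom-escapes {A} no-gp 5 7 a (λ ()) (odd⇒pos a (coprime-10⇒odd a (coprime-30⇒coprime-10 a coprime)))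

  two-odd⇒small : ∀ j m i → Valid (two j m) → ¬ 2 ∣ progression (two j m) i →
                  progression (two j m) i * 2 ^ (k ∸ 1) ≤ n
  two-odd⇒small j m i (_ , m≤X) odd-term rewrite two≡ j m i with j * k + i in e
  ... | suc e′ = ⊥-elim (odd-term (divides (2 ^ e′ * m) (swap (2 ^ e′) m)))
    where swap : ∀ x m → 2 * x * m ≡ x * m * 2
          swap = solve-∀
  ... | zero with m*n≡0⇒m≡0∨n≡0 j (m+n≡0⇒m≡0 (j * k) e)
  ...   | inj₂ k≡0 = ⊥-elim (≢-nonZero⁻¹ k k≡0)
  ...   | inj₁ refl = subst (λ x → x * 2 ^ (k ∸ 1) ≤ n) (sym (+-identityʳ m)) (≤/⇒*≤ n (T 0) {{T≢0 0}} m≤X)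

  large-odd≢two : ∀ j m i {y} → Valid (two j m) → ¬ 2 ∣ y → n < y * 2 ^ (k ∸ 1) → progression (two j m) i ≢ y
  large-odd≢two j m i v odd-y large refl = <⇒≱ large (two-odd⇒small j m i v odd-y)

  fiveThirds-large : ∀ a i → Valid (fiveThirds a) → i < k → n < geom k 3 5 a i * 2 ^ (k ∸ 1)
  fiveThirds-large a i (_ , lo<a , _) i<k =
    <-≤-trans (/<⇒<* n _ lo<a) (geom-≥-* k 3 5 a i 2 (s≤s (s≤s (s≤s z≤n))) i<k)

  sevenFifths-large : ∀ a i → Valid (sevenFifths a) → i < k → n < geom k 5 7 a i * 2 ^ (k ∸ 1)
  sevenFifths-large a i (_ , lo<a , _) i<k =
    <-≤-trans (/<⇒<* n _ lo<a) (geom-≥-* k 5 7 a i 2 (s≤s (s≤s (s≤s (s≤s (s≤s z≤n))))) i<k)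

  fiveThirds-odd : ∀ a i → Valid (fiveThirds a) → ¬ 2 ∣ geom k 3 5 a i
  fiveThirds-odd a i (coprime , _) =
    ∤-geom k 3 5 a i prime[2] (from-no (2 ∣? 3)) (from-no (2 ∣? 5)) (odd⇒∤ a (coprime-10⇒odd a coprime))

  sevenFifths-odd : ∀ a i → Valid (sevenFifths a) → ¬ 2 ∣ geom k 5 7 a i
  sevenFifths-odd a i (coprime , _) =
    ∤-geom k 5 7 a i prime[2] (from-no (2 ∣? 5)) (from-no (2 ∣? 7))
      (odd⇒∤ a (coprime-10⇒odd a (coprime-30⇒coprime-10 a coprime)))

  sevenFifths<fiveThirds : ∀ a b → Valid (fiveThirds a) → Valid (sevenFifths b) → b < a
  sevenFifths<fiveThirds a b (_ , lo<a , _) (_ , _ , b≤hi) = *-cancelʳ-< (7 ^ (k ∸ 1)) b a (begin-strict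
    b * 7 ^ (k ∸ 1) ≤⟨ ≤/⇒*≤ n _ b≤hi ⟩
    n               <⟨ /<⇒<* n _ lo<a ⟩
    a * 6 ^ (k ∸ 1) ≤⟨ *-monoʳ-≤ a (^-monoˡ-≤ (k ∸ 1) (s≤s (s≤s (s≤s (s≤s (s≤s (s≤s z≤n))))))) ⟩
    a * 7 ^ (k ∸ 1) ∎)
    where open ≤-Reasoning

  two⊥fiveThirds : ∀ j m a → Valid (two j m) → Valid (fiveThirds a) → Disjoint k (progression (two j m)) (geom k 3 5 a)
  two⊥fiveThirds j m a v v′ i i′ _ i′<k = large-odd≢two j m i v (fiveThirds-odd a i′ v′) (fiveThirds-large a i′ v′ i′<k)

  two⊥sevenFifths : ∀ j m a → Valid (two j m) → Valid (sevenFifths a) → Disjoint k (progression (two j m)) (geom k 5 7 a)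
  two⊥sevenFifths j m a v v′ i i′ _ i′<k = large-odd≢two j m i v (sevenFifths-odd a i′ v′) (sevenFifths-large a i′ v′ i′<k)

  fiveThirds⊥sevenFifths : ∀ a b → Valid (fiveThirds a) → Valid (sevenFifths b) → Disjoint k (geom k 3 5 a) (geom k 5 7 b)
  fiveThirds⊥sevenFifths a b v@(coprime-a , _) v′@(coprime-b , _) i i′ i<k i′<k =
    geom-3-5≢geom-5-7 k a b i i′ i<k i′<k (coprime-10⇒5∤ a coprime-a) (coprime-30⇒3∤ b coprime-b)
      (coprime-10⇒5∤ b (coprime-30⇒coprime-10 b coprime-b)) (sevenFifths<fiveThirds a b v v′)

  valid-disjoint : ∀ l l′ → Valid l → Valid l′ → l ≢ l′ → Disjoint k (progression l) (progression l′)
  valid-disjoint (two j m) (two j′ m′) (odd-m , _) (odd-m′ , _) l≢l′ i i′ i<k i′<k eq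
    with ^-*-injective 2 (j * k + i) (j′ * k + i′) m m′ (odd⇒∤ m odd-m) (odd⇒∤ m′ odd-m′)
           (trans (sym (two≡ j m i)) (trans eq (two≡ j′ m′ i′)))
  ... | exponents≡ , refl = l≢l′ (cong (λ j → two j m) (begin
    j                       ≡⟨ [m*n+o]/n≡m j k i i<k ⟨
    (j * k + i) / k         ≡⟨ cong (_/ k) exponents≡ ⟩
    (j′ * k + i′) / k       ≡⟨ [m*n+o]/n≡m j′ k i′ i′<k ⟩
    j′                      ∎))
    where open ≡-Reasoning
  valid-disjoint (two j m) (fiveThirds a) v v′ _ = two⊥fiveThirds j m a v v′
  valid-disjoint (two j m) (sevenFifths a) v v′ _ = two⊥sevenFifths j m a v v′
  valid-disjoint (fiveThirds a) (two j m) v v′ _ = Disjoint-sym (two⊥fiveThirds j m a v′ v)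
  valid-disjoint (fiveThirds a) (fiveThirds a′) (coprime , _) (coprime′ , _) l≢l′ i i′ _ _ eq =
    l≢l′ (cong fiveThirds (geom-injectiveʳ k 3 a a′ i i′ prime-5 (from-no (5 ∣? 3))
                            (coprime-10⇒5∤ a coprime) (coprime-10⇒5∤ a′ coprime′) eq))
  valid-disjoint (fiveThirds a) (sevenFifths b) v v′ _ = fiveThirds⊥sevenFifths a b v v′
  valid-disjoint (sevenFifths a) (two j m) v v′ _ = Disjoint-sym (two⊥sevenFifths j m a v′ v)
  valid-disjoint (sevenFifths a) (fiveThirds b) v v′ _ = Disjoint-sym (fiveThirds⊥sevenFifths b a v′ v)
  valid-disjoint (sevenFifths a) (sevenFifths a′) (coprime , _) (coprime′ , _) l≢l′ i i′ i<k i′<k eq =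
    l≢l′ (cong sevenFifths (geom-injectiveˡ k 7 a a′ i i′ prime-5 (from-no (5 ∣? 7))
      (coprime-10⇒5∤ a (coprime-30⇒coprime-10 a coprime)) (coprime-10⇒5∤ a′ (coprime-30⇒coprime-10 a′ coprime′))
      i<k i′<k eq))

  odds : ℕ → List ℕ
  odds j = select odd 0 (suc (X j))

  as₂ as₃ : List ℕ
  as₂ = select coprime-10 (suc lo₂) (hi₂ ∸ lo₂)
  as₃ = select coprime-30 (suc lo₃) (hi₃ ∸ lo₃)

  twos : ℕ → List Label
  twos zero = []
  twos (suc J) = twos J ++ map (two J) (odds J)

  labels : ℕ → List Label
  labels J = twos J ++ (map fiveThirds as₂ ++
                        map sevenFifths as₃)

  Layer : ℕ → Label → Set
  Layer J (two j _) = j < J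
  Layer J _ = ⊥

  twos-layer : ∀ J → All (Layer J) (twos J)
  twos-layer zero = []
  twos-layer (suc J) =
    All.++⁺ (All.map widen (twos-layer J)) (All.map⁺ (All.universal (λ _ → n<1+n J) (odds J)))
    where
    widen : ∀ {l} → Layer J l → Layer (suc J) l
    widen {two _ _} j<J = m<n⇒m<1+n j<J

  twos-valid : ∀ J → All Valid (twos J)
  twos-valid zero = []
  twos-valid (suc J) = All.++⁺ (twos-valid J) (All.map⁺ (All.map valid (select-sound odd 0 (suc (X J)))))
    where
    valid : ∀ {m} → InWindow odd 0 (suc (X J)) m → Valid (two J m)
    valid (_ , m<1+X , odd-m) = odd-m , ≤-pred m<1+X

  labels-valid : ∀ J → All Valid (labels J)
  labels-valid J = All.++⁺ (twos-valid J) (All.++⁺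
    (All.map⁺ (All.map (λ { (lo<a , a<lo+1+len , coprime) → coprime , lo<a , window-≤ lo₂≤hi₂ a<lo+1+len })
                       (select-sound coprime-10 (suc lo₂) (hi₂ ∸ lo₂))))
    (All.map⁺ (All.map (λ { (lo<a , a<lo+1+len , coprime) → coprime , lo<a , window-≤ lo₃≤hi₃ a<lo+1+len })
                       (select-sound coprime-30 (suc lo₃) (hi₃ ∸ lo₃)))))
    where
    window-≤ : ∀ {lo hi a} → lo ≤ hi → a < suc lo + (hi ∸ lo) → a ≤ hi
    window-≤ {lo} {hi} {a} lo≤hi a< = ≤-pred (subst (a <_) (cong suc (m+[n∸m]≡n lo≤hi)) a<)
    lo₂≤hi₂ : lo₂ ≤ hi₂
    lo₂≤hi₂ = /-monoʳ-≤ n (^-monoˡ-≤ (k ∸ 1) (s≤s (s≤s (s≤s (s≤s (s≤s z≤n))))))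
    lo₃≤hi₃ : lo₃ ≤ hi₃
    lo₃≤hi₃ = /-monoʳ-≤ n (^-monoˡ-≤ (k ∸ 1) (s≤s (s≤s (s≤s (s≤s (s≤s (s≤s (s≤s z≤n))))))))

  twos-unique : ∀ J → Unique (twos J)
  twos-unique zero = []
  twos-unique (suc J) = AllPairs.++⁺ (twos-unique J)
    (Unique.map⁺ (λ { refl → refl }) (select-unique odd 0 (suc (X J))))
    (All.map (λ layer → All.map⁺ (All.universal (λ _ → below layer) (odds J))) (twos-layer J))
    where
    below : ∀ {l m} → Layer J l → l ≢ two J m
    below {two j _} j<J refl = <-irrefl refl j<J

  labels-unique : ∀ J → Unique (labels J)
  labels-unique J = AllPairs.++⁺ (twos-unique J)
    (AllPairs.++⁺ (Unique.map⁺ (λ { refl → refl }) (select-unique coprime-10 (suc lo₂) (hi₂ ∸ lo₂)))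
                  (Unique.map⁺ (λ { refl → refl }) (select-unique coprime-30 (suc lo₃) (hi₃ ∸ lo₃)))
                  (All.map⁺ (All.universal (λ _ → All.map⁺ (All.universal (λ _ ()) as₃)) as₂)))
    (All.map (λ layer → All.++⁺ (All.map⁺ (All.universal (λ _ → two≢fiveThirds layer) as₂))
                                (All.map⁺ (All.universal (λ _ → two≢sevenFifths layer) as₃))) (twos-layer J))
    where
    two≢fiveThirds : ∀ {l a} → Layer J l → l ≢ fiveThirds a
    two≢fiveThirds {two _ _} _ ()
    two≢sevenFifths : ∀ {l a} → Layer J l → l ≢ sevenFifths a
    two≢sevenFifths {two _ _} _ ()

  d : ℕ → ℕ
  d j = length (odds j)

  c₂ c₃ : ℕ
  c₂ = length as₂
  c₃ = length as₃

  length-twos : ∀ J → length (twos J) + J ≡ sum< J (λ j → d j + 1)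
  length-twos zero = refl
  length-twos (suc J) rewrite length-++ (twos J) {map (two J) (odds J)}
                            | length-map (two J) (odds J) | sym (length-twos J) =
    regroup (length (twos J)) (d J) J
    where regroup : ∀ t d J → t + d + suc J ≡ t + J + (d + 1)
          regroup = solve-∀

  length-labels : ∀ J → length (labels J) ≡ length (twos J) + (c₂ + c₃)
  length-labels J rewrite length-++ (twos J) {map fiveThirds as₂ ++
                                               map sevenFifths as₃}
                        | length-++ (map fiveThirds as₂)
                                    {map sevenFifths as₃}
                        | length-map fiveThirds as₂
                        | length-map sevenFifths as₃ = refl

  count+families≤ : ∀ {A} → ¬ ContainsGP k A → ∀ J → count A n + (sum< J (λ j → d j + 1) + c₂ + c₃) ≤ n + J
  count+families≤ {A} no-gp J = begin
    count A n + (sum< J (λ j → d j + 1) + c₂ + c₃)       ≡⟨ cong (λ s → count A n + (s + c₂ + c₃)) (length-twos J) ⟨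
    count A n + (length (twos J) + J + c₂ + c₃)          ≡⟨ regroup (count A n) (length (twos J)) J c₂ c₃ ⟩
    count A n + (length (twos J) + (c₂ + c₃)) + J        ≡⟨ cong (λ t → count A n + t + J) (length-labels J) ⟨
    count A n + length (labels J) + J                    ≡⟨ cong (λ t → count A n + t + J) (length-map progression (labels J)) ⟨
    count A n + length (map progression (labels J)) + J  ≤⟨ +-monoˡ-≤ J (Witness.count+length≤ A k n _
                                                              (All.map⁺ (All.map (λ {l} → valid-escaping {A} no-gp l) (labels-valid J)))
                                                              (AllPairs-map (λ {l} {l′} → valid-disjoint l l′) (labels-valid J) (labels-unique J))) ⟩
    n + J                                                ∎
    where
    open ≤-Reasoning
    regroup : ∀ c t J c₂ c₃ → c + (t + J + c₂ + c₃) ≡ c + (t + (c₂ + c₃)) + J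
    regroup = solve-∀

  suc[k∸1]≡k : suc (k ∸ 1) ≡ k
  suc[k∸1]≡k = m+[n∸m]≡n {1} {k} (>-nonZero⁻¹ k)

  layer-size : ∀ j → n ≤ (2 ^ k) ^ suc j * (d j + 1)
  layer-size j = begin
    n                                 ≤⟨ <⇒≤ (n<[n/d+1]*d n (T j) {{T≢0 j}}) ⟩
    suc (X j) * T j                   ≤⟨ *-monoˡ-≤ (T j) (subst₂ _≤_ (+-identityʳ (suc (X j))) (double (d j))
                                           (Odd.#select-≥ 0 (suc (X j)))) ⟩
    2 * (d j + 1) * T j               ≡⟨ shift (d j + 1) (T j) ⟩
    (d j + 1) * 2 ^ suc (j * k + (k ∸ 1)) ≡⟨ cong (λ e → (d j + 1) * 2 ^ e) exponent ⟩
    (d j + 1) * 2 ^ (k * suc j)       ≡⟨ cong ((d j + 1) *_) (^-*-assoc 2 k (suc j)) ⟨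
    (d j + 1) * (2 ^ k) ^ suc j       ≡⟨ *-comm (d j + 1) _ ⟩
    (2 ^ k) ^ suc j * (d j + 1)       ∎
    where
    open ≤-Reasoning
    module Odd = Periodic odd 2 odd-periodic
    double : ∀ x → 2 * x + 1 * 2 ≡ 2 * (x + 1)
    double = solve-∀
    shift : ∀ a b → 2 * a * b ≡ a * (2 * b)
    shift = solve-∀
    exponent : suc (j * k + (k ∸ 1)) ≡ k * suc j
    exponent = begin-equality
      suc (j * k + (k ∸ 1))   ≡⟨ +-suc (j * k) (k ∸ 1) ⟨
      j * k + suc (k ∸ 1)     ≡⟨ cong (j * k +_) suc[k∸1]≡k ⟩
      j * k + k               ≡⟨ +-comm (j * k) k ⟩
      suc j * k               ≡⟨ *-comm (suc j) k ⟩
      k * suc j               ∎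

  twos-total : ∀ J → n * (2 ^ k) ^ J ≤ (2 ^ k ∸ 1) * (2 ^ k) ^ J * sum< J (λ j → d j + 1) + n
  twos-total J = subst (λ K → n * K ^ J ≤ (2 ^ k ∸ 1) * K ^ J * sum< J (λ j → d j + 1) + n) suc[2^k∸1]≡2^k
    (geometric-lower-bound (2 ^ k ∸ 1) (λ j → d j + 1) n J
      (λ j → subst (λ K → n ≤ K ^ suc j * (d j + 1)) (sym suc[2^k∸1]≡2^k) (layer-size j)))
    where
    suc[2^k∸1]≡2^k : suc (2 ^ k ∸ 1) ≡ 2 ^ k
    suc[2^k∸1]≡2^k = m+[n∸m]≡n {1} (m^n>0 2 k)

  fiveThirds-count : 4 * n * 6 ^ (k ∸ 1) ≤ 4 * n * 5 ^ (k ∸ 1) + (10 * c₂ + 40 + 4) * (5 ^ (k ∸ 1) * 6 ^ (k ∸ 1))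
  fiveThirds-count = Periodic.#select-between coprime-10 10 coprime-10-periodic n (5 ^ (k ∸ 1)) (6 ^ (k ∸ 1))
    (^-monoˡ-≤ (k ∸ 1) (s≤s (s≤s (s≤s (s≤s (s≤s z≤n))))))

  sevenFifths-count : 8 * n * 10 ^ (k ∸ 1) ≤ 8 * n * 7 ^ (k ∸ 1) + (30 * c₃ + 240 + 8) * (7 ^ (k ∸ 1) * 10 ^ (k ∸ 1))
  sevenFifths-count = Periodic.#select-between coprime-30 30 coprime-30-periodic n (7 ^ (k ∸ 1)) (10 ^ (k ∸ 1))
    (^-monoˡ-≤ (k ∸ 1) (s≤s (s≤s (s≤s (s≤s (s≤s (s≤s (s≤s z≤n))))))))

  geometric-tail : ∀ E → 2 * E ≤ (2 ^ k ∸ 1) * (2 ^ k) ^ (2 * E)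
  geometric-tail E = begin
    2 * E                           ≤⟨ <⇒≤ (n<2^n (2 * E)) ⟩
    2 ^ (2 * E)                     ≤⟨ ^-monoˡ-≤ (2 * E) 2≤2^k ⟩
    (2 ^ k) ^ (2 * E)               ≤⟨ m≤n*m _ (2 ^ k ∸ 1) ⟩
    (2 ^ k ∸ 1) * (2 ^ k) ^ (2 * E) ∎
    where open ≤-Reasoning

  density-bound : ∀ {A} → ¬ ContainsGP k A → ∀ E .{{_ : NonZero E}} .{{_ : NonZero n}} →
                  2 * E * (2 * E + 14) ≤ n → ℤ.+ count A n ℚ./ n ℚ.≤ bound k ℚ.+ inv E
  density-bound {A} no-gp E n-large =
    cleared⇒≤ (count A n) n (2 ^ k ∸ 1) (5 ^ (k ∸ 1)) (6 ^ (k ∸ 1)) (7 ^ (k ∸ 1)) (10 ^ (k ∸ 1)) E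
      (Assembly.cleared (count A n) n (2 ^ k ∸ 1) ((2 ^ k) ^ J) (sum< J (λ j → d j + 1)) c₂ c₃
         (5 ^ (k ∸ 1)) (6 ^ (k ∸ 1)) (7 ^ (k ∸ 1)) (10 ^ (k ∸ 1)) E J
         (count+families≤ no-gp J) (twos-total J) (geometric-tail E) fiveThirds-count sevenFifths-count n-large
         {{m^n≢0 (2 ^ k) J {{m^n≢0 2 k}}}})
    where J = 2 * E

corollary1 : (k : ℕ) → 3 ≤ k → (A : Set⁺) → A 0 ≡ false →
    ¬ ContainsGP k A → UpperDensity≤ A (bound k)
-- count only sees 1, …, n, so the hypothesis on A 0 is not needed.
corollary1 k 3≤k A _ no-gp ε 0<ε = N , ratio≤bound+ε
  where
  E N : ℕ
  E = ℚ.↧ₙ ε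
  N = 2 * E * (2 * E + 14)
  ratio≤bound+ε : ∀ m → N ≤ m → ratio A m ℚ.≤ bound k ℚ.+ ε
  ratio≤bound+ε m N≤m = ℚ.≤-trans
    (Families.density-bound k {{>-nonZero (≤-trans (s≤s z≤n) 3≤k)}} (suc m) no-gp E (m≤n⇒m≤1+n N≤m))
    (ℚ.+-monoʳ-≤ (bound k) (inv-↧ₙ≤ ε 0<ε))
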